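{- Let $m \ge 2$, $n\ge 1$ be integers, $G = \langle e_1\rangle\oplus\langle e_2\rangle$ with $\operatorname{ord}(e_1)=m$, $\operatorname{ord}(e_2)=mn$, $K$ a splitting field of $G$, $\zeta\in K$ a primitive $mn$-th root of unity, and $\psi,\varphi\in\widehat G$ defined by $\psi(e_1)=\zeta^n$, $\psi(e_2)=1$, $\varphi(e_1)=1$, $\varphi(e_2)=\zeta$. Let $s\in[0,m]$ and let $S = g_1\cdot\ldots\cdot g_{s+(m-s)m}$ be a sequence over $G$ such that either $g_1=\dots=g_s = ke_1+e_2$ for some $k\in[0,m-1]$, or $g_1,\dots,g_s\in\{ke_1+mle_2 : k\in[0,m-1],\ l\in\mathbb N_0\}$. Then there exist $\chi_1,\dots,\chi_{s+(m-s)m}\in\widehat G$ such that $\langle\psi,\varphi^n\rangle\subset\bigcup_{i=1}^{s+(m-s)m}\chi_i\langle g_i\rangle^\perp$.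
   Context: $[a,b]=\{x\in\mathbb Z: a\le x\le b\}$, $\mathbb N_0$ the nonnegative integers. A field $K$ is a splitting field of $G$ if the group of $\exp(G)$-th roots of unity in $K$ has exactly $\exp(G)$ elements. $\widehat G=\operatorname{Hom}(G,K^\times)$ is the character group (multiplicative, pointwise). For a subgroup $U\subset G$, $U^\perp=\{\chi\in\widehat G:\chi(u)=1\ \forall u\in U\}$, and $\chi U^\perp$ denotes the coset of $U^\perp$ containing $\chi$. $\langle\psi,\varphi^n\rangle$ is the subgroup of $\widehat G$ generated by $\psi$ and $\varphi^n$. -}

module Defs where

open import Level using (Level; _⊔_)
open import Data.Nat using (ℕ; zero; suc; _+_; _*_; _≤_; _<_; NonZero)
open import Data.Nat.DivMod using (_%_; m%n<n)
open import Data.Nat.Properties using (m*n≢0)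
open import Data.Fin using (Fin; toℕ; fromℕ<)
open import Data.Product using (Σ; _×_; _,_; ∃)
open import Relation.Binary.PropositionalEquality using (_≡_)
open import Relation.Nullary using (¬_)
open import Algebra.Bundles using (CommutativeRing)
import Algebra.Bundles
import Algebra.Definitions.RawSemiring as RS

IsField : ∀ {c ℓ} → CommutativeRing c ℓ → Set (c ⊔ ℓ)
IsField K = ¬ (1# ≈ 0#) × (∀ x → ¬ (x ≈ 0#) → Σ Carrier λ y → x *K y ≈ 1#)
  where open CommutativeRing K renaming (_*_ to _*K_; _+_ to _+K_)

module Setup {c ℓ} (K : CommutativeRing c ℓ) (m n : ℕ)
             .{{m≢0 : NonZero m}} .{{n≢0 : NonZero n}} where

  open CommutativeRing K renaming (_*_ to _*K_; _+_ to _+K_)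
  open RS (Algebra.Bundles.Semiring.rawSemiring semiring) using (_^_)

  private
    instance
      mn≢0 : NonZero (m * n)
      mn≢0 = m*n≢0 m n

  -- G = ⟨e₁⟩ ⊕ ⟨e₂⟩ ≅ Z_m ⊕ Z_{mn}, elements as pairs of residues.
  G : Set
  G = Fin m × Fin (m * n)

  mkG : ℕ → ℕ → G
  mkG a b = fromℕ< (m%n<n a m) , fromℕ< (m%n<n b (m * n))

  e₁ e₂ 0G : G
  e₁ = mkG 1 0
  e₂ = mkG 0 1
  0G = mkG 0 0

  _+G_ : G → G → G
  (a , b) +G (a' , b') = mkG (toℕ a + toℕ a') (toℕ b + toℕ b')

  _·G_ : ℕ → G → G
  k ·G (a , b) = mkG (k * toℕ a) (k * toℕ b)

  record Char : Set (c ⊔ ℓ) where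
    field
      χ       : G → Carrier
      nonzero : ∀ g → ¬ (χ g ≈ 0#)
      hom     : ∀ g h → χ (g +G h) ≈ χ g *K χ h
  open Char public

  InPerp : G → Char → Set ℓ
  InPerp g τ = ∀ (k : ℕ) → χ τ (k ·G g) ≈ 1#

  InCoset : Char → G → Char → Set (c ⊔ ℓ)
  InCoset χ₀ g ρ = Σ Char λ τ → InPerp g τ × (∀ h → χ ρ h ≈ χ χ₀ h *K χ τ h)

  -- ρ ∈ ⟨ψ, φ^n⟩ : ρ = ψ^a (φ^n)^b pointwise for some a, b
  -- (natural exponents suffice, all characters having finite order)
  InGen2 : Char → Char → Char → Set ℓ
  InGen2 ψ φ ρ = Σ ℕ λ a → Σ ℕ λ b →
                   ∀ h → χ ρ h ≈ (χ ψ h ^ a) *K ((χ φ h ^ n) ^ b)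

  RootsOfUnityCard : ℕ → Set (c ⊔ ℓ)
  RootsOfUnityCard N =
    Σ (Fin N → Carrier) λ f →
        (∀ i → f i ^ N ≈ 1#)
      × (∀ i j → f i ≈ f j → i ≡ j)
      × (∀ x → x ^ N ≈ 1# → ∃ λ i → x ≈ f i)

  -- K is a splitting field of G (exp(G) = mn)
  IsSplittingField : Set (c ⊔ ℓ)
  IsSplittingField = IsField K × RootsOfUnityCard (m * n)

  IsPrimitiveRoot : ℕ → Carrier → Set ℓ
  IsPrimitiveRoot N ζ = (ζ ^ N ≈ 1#) × (∀ k → 1 ≤ k → k < N → ¬ (ζ ^ k ≈ 1#))

  _^K_ : Carrier → ℕ → Carrier
  _^K_ = _^_

-- Put w = ζⁿ, an m-th root of unity.  On h = x e₁ + y e₂ one has ψ(h) = w^x and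
-- φⁿ(h) = w^y, so every ρ = ψᵃ(φⁿ)ᵇ is h ↦ w^(a x + b y): it is described by an
-- exponent pair (a, b) modulo m.  Each pair (α, β) gives such a character
-- C α β, and ρ lies in the coset (C α β)⟨g⟩^⊥ as soon as the difference
-- (a - α, b - β) kills g modulo m; in particular when (α, β) ≋ (a, b).
--
-- A residue of the exponent pair of ρ
-- decides whether ρ lies in a coset along some gᵢ, i < s (using the assumed
-- shape of gᵢ), or coincides with a character of the second block.  Only the
-- field axioms and ζ^(mn) = 1 are used.
module Submission where

open import Defs
open import Level using (_⊔_)
open import Data.Nat using (ℕ; _∸_; _≤_; _<_; NonZero) renaming (_*_ to _*ℕ_; _+_ to _+ℕ_)
open import Data.Fin using (Fin; toℕ)
open import Data.Product using (Σ; _×_; ∃)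
open import Data.Sum using (_⊎_)
open import Relation.Binary.PropositionalEquality using (_≡_)
open import Algebra.Bundles using (CommutativeRing)

open import Data.Nat using (zero; suc; _*_; _+_; pred; _<?_)
open import Data.Nat.Properties
  using (*-comm; suc-pred; ≮⇒≥; ∸-monoˡ-<; m+[n∸m]≡n; +-identityʳ; m*n≢0)
open import Data.Nat.DivMod
  using (_%_; _/_; m%n<n; m%n%n≡m%n; m*n%n≡0; %-distribˡ-+; %-distribˡ-*;
         m∣n⇒o%n%m≡o%m; m≡m%n+[m/n]*n; m<n⇒m%n≡m)
open import Data.Nat.Divisibility using (m∣m*n)
open import Data.Nat.Tactic.RingSolver using (solve-∀)
open import Data.Fin using (fromℕ<; splitAt; remQuot; combine; _↑ˡ_; _↑ʳ_)
open import Data.Fin.Properties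
  using (toℕ-fromℕ<; toℕ-injective; toℕ<n; toℕ-↑ˡ; splitAt-↑ˡ; splitAt-↑ʳ; remQuot-combine)
open import Data.Product using (_,_; proj₁; proj₂; uncurry)
open import Data.Sum using ([_,_]′)
open import Function.Base using (_∘_)
open import Relation.Binary.Bundles using (Setoid)
import Relation.Binary.Construct.On as On
import Relation.Binary.Reasoning.Setoid as SetoidReasoning
open import Relation.Binary.PropositionalEquality as P using (refl; cong; cong₂; subst)
open import Relation.Nullary using (yes; no; ¬_)

module Congruence (m : ℕ) .{{_ : NonZero m}} where

  ≋-setoid : Setoid _ _
  ≋-setoid = On.setoid (P.setoid ℕ) (_% m)

  infix 4 _≋_
  _≋_ : ℕ → ℕ → Set
  _≋_ = Setoid._≈_ ≋-setoid

  open Setoid ≋-setoid public using ()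
    renaming (refl to ≋-refl; reflexive to ≋-reflexive; sym to ≋-sym; trans to ≋-trans)
  module ≋-Reasoning = SetoidReasoning ≋-setoid

  +-≋ : ∀ {a a' b b'} → a ≋ a' → b ≋ b' → a + b ≋ a' + b'
  +-≋ {a} {a'} {b} {b'} p q = P.trans (%-distribˡ-+ a b m)
    (P.trans (cong₂ (λ u v → (u + v) % m) p q) (P.sym (%-distribˡ-+ a' b' m)))

  *-≋ : ∀ {a a' b b'} → a ≋ a' → b ≋ b' → a * b ≋ a' * b'
  *-≋ {a} {a'} {b} {b'} p q = P.trans (%-distribˡ-* a b m)
    (P.trans (cong₂ (λ u v → (u * v) % m) p q) (P.sym (%-distribˡ-* a' b' m)))

  mod-≋ : ∀ a → a % m ≋ a
  mod-≋ a = m%n%n≡m%n a m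

  mod-multiple-≋ : ∀ d .{{_ : NonZero (m * d)}} a → a % (m * d) ≋ a
  mod-multiple-≋ d a = m∣n⇒o%n%m≡o%m m (m * d) a (m∣m*n d)

  multiple-≋0 : ∀ a → m * a ≋ 0
  multiple-≋0 a = P.trans (P.subst (λ t → t % m ≡ 0) (*-comm a m) (m*n%n≡0 a m))
                          (P.sym (m*n%n≡0 0 m))

  neg : ℕ → ℕ
  neg a = pred m * a

  +-neg : ∀ a → a + neg a ≋ 0
  +-neg a = P.subst (λ M → (M * a) % m ≡ 0 % m) (P.sym (suc-pred m)) (multiple-≋0 a)

  neg-≋ : ∀ {a a'} → a ≋ a' → neg a ≋ neg a'
  neg-≋ = *-≋ (≋-refl {pred m})

  cancel-neg : ∀ γ b → γ + (b + neg γ) ≋ b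
  cancel-neg γ b = begin
      γ + (b + neg γ)   ≡⟨ regroup γ b (neg γ) ⟩
      b + (γ + neg γ)   ≈⟨ +-≋ (≋-refl {b}) (+-neg γ) ⟩
      b + 0             ≡⟨ +-identityʳ b ⟩
      b                 ∎
    where
      open ≋-Reasoning
      regroup : ∀ x y z → x + (y + z) ≡ y + (x + z)
      regroup = solve-∀

  cancel-negˡ : ∀ x b → neg x + (x + b) ≋ b
  cancel-negˡ x b = begin
      neg x + (x + b)   ≡⟨ regroup (neg x) x b ⟩
      (x + neg x) + b   ≈⟨ +-≋ (+-neg x) (≋-refl {b}) ⟩
      b                 ∎
    where
      open ≋-Reasoning
      regroup : ∀ x y z → x + (y + z) ≡ (y + x) + z
      regroup = solve-∀

  linear-split : ∀ {a b} α β α' β' x y → α + α' ≋ a → β + β' ≋ b →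
                 a * x + b * y ≋ (α * x + β * y) + (α' * x + β' * y)
  linear-split {a} {b} α β α' β' x y p q = ≋-sym (begin
      (α * x + β * y) + (α' * x + β' * y) ≡⟨ regroup α β α' β' x y ⟩
      (α + α') * x + (β + β') * y         ≈⟨ +-≋ (*-≋ p ≋-refl) (*-≋ q ≋-refl) ⟩
      a * x + b * y                       ∎)
    where
      open ≋-Reasoning
      regroup : ∀ α β α' β' x y →
                (α * x + β * y) + (α' * x + β' * y) ≡ (α + α') * x + (β + β') * y
      regroup = solve-∀

  scale-≋0 : ∀ α β k x y → α * x + β * y ≋ 0 → α * (k * x) + β * (k * y) ≋ 0
  scale-≋0 α β k x y vanishes = begin
      α * (k * x) + β * (k * y)   ≡⟨ scale α β k x y ⟩
      k * (α * x + β * y)         ≈⟨ *-≋ (≋-refl {k}) vanishes ⟩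
      k * 0                       ≡⟨ *-comm k 0 ⟩
      0                           ∎
    where
      open ≋-Reasoning
      scale : ∀ α β k x y → α * (k * x) + β * (k * y) ≡ k * (α * x + β * y)
      scale = solve-∀

-- A family indexed by Fin (p + q * r), given as a block of p entries followed
-- by a q × r block.  This is the shape of the index set s + (m - s) m.
module _ {a} {A : Set a} {p q r : ℕ} where

  blocks : (Fin p → A) → (Fin q → Fin r → A) → Fin (p + q * r) → A
  blocks f g i = [ f , uncurry g ∘ remQuot r ]′ (splitAt p i)

  blocks-first : ∀ f g (j : Fin p) → blocks f g (j ↑ˡ (q * r)) ≡ f j
  blocks-first f g j rewrite splitAt-↑ˡ p j (q * r) = refl

  blocks-second : ∀ f g (u : Fin q) (v : Fin r) → blocks f g (p ↑ʳ combine u v) ≡ g u v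
  blocks-second f g u v = P.trans
    (cong [ f , uncurry g ∘ remQuot r ]′ (splitAt-↑ʳ p (q * r) (combine u v)))
    (cong (uncurry g) (remQuot-combine u v))

module Characters {c ℓ} (K : CommutativeRing c ℓ) (m n : ℕ)
                  .{{_ : NonZero m}} .{{_ : NonZero n}} where

  open CommutativeRing K hiding (zero; *-comm; +-identityʳ)
    renaming (_*_ to _*K_; _+_ to _+K_; refl to ≈-refl; sym to ≈-sym; trans to ≈-trans)
  open Setup K m n
  open Congruence m
  open import Algebra.Properties.Semiring.Exp semiring using (_^_; ^-congˡ; ^-congʳ; ^-homo-*; ^-assocʳ)
  open import Algebra.Properties.CommutativeSemigroup *-commutativeSemigroup using (x∙yz≈y∙xz)
  module ≈-Reasoning = SetoidReasoning setoid

  private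
    instance
      mn≢0 : NonZero (m * n)
      mn≢0 = m*n≢0 m n

  coord₁ coord₂ : G → ℕ
  coord₁ h = toℕ (proj₁ h)
  coord₂ h = toℕ (proj₂ h)

  coord₁-mkG : ∀ X Y → coord₁ (mkG X Y) ≡ X % m
  coord₁-mkG X Y = toℕ-fromℕ< (m%n<n X m)

  coord₂-mkG : ∀ X Y → coord₂ (mkG X Y) ≡ Y % (m * n)
  coord₂-mkG X Y = toℕ-fromℕ< (m%n<n Y (m * n))

  mkG-coords : ∀ h → mkG (coord₁ h) (coord₂ h) ≡ h
  mkG-coords (x , y) = cong₂ _,_
    (toℕ-injective (P.trans (toℕ-fromℕ< _) (m<n⇒m%n≡m (toℕ<n x))))
    (toℕ-injective (P.trans (toℕ-fromℕ< _) (m<n⇒m%n≡m (toℕ<n y))))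

  mkG-cong : ∀ {a b a' b'} → a % m ≡ a' % m → b % (m * n) ≡ b' % (m * n) → mkG a b ≡ mkG a' b'
  mkG-cong p q = cong₂ _,_
    (toℕ-injective (P.trans (toℕ-fromℕ< _) (P.trans p (P.sym (toℕ-fromℕ< _)))))
    (toℕ-injective (P.trans (toℕ-fromℕ< _) (P.trans q (P.sym (toℕ-fromℕ< _)))))

  mkG-+ : ∀ a b a' b' → mkG a b +G mkG a' b' ≡ mkG (a + a') (b + b')
  mkG-+ a b a' b' = mkG-cong
    (P.trans (cong₂ (λ u v → (u + v) % m) (coord₁-mkG a b) (coord₁-mkG a' b'))
             (P.sym (%-distribˡ-+ a a' m)))
    (P.trans (cong₂ (λ u v → (u + v) % (m * n)) (coord₂-mkG a b) (coord₂-mkG a' b'))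
             (P.sym (%-distribˡ-+ b b' (m * n))))

  linear-mkG : ∀ α β X Y → α * coord₁ (mkG X Y) + β * coord₂ (mkG X Y) ≋ α * X + β * Y
  linear-mkG α β X Y rewrite coord₁-mkG X Y | coord₂-mkG X Y =
    +-≋ (*-≋ (≋-refl {α}) (mod-≋ X)) (*-≋ (≋-refl {β}) (mod-multiple-≋ n Y))

  1^ : ∀ k → 1# ^ k ≈ 1#
  1^ zero    = ≈-refl
  1^ (suc k) = ≈-trans (*-congˡ (1^ k)) (*-identityʳ 1#)

  module OnGenerators (isField : IsField K) where

    open ≈-Reasoning

    -- χ(0) is a nonzero idempotent, hence 1
    character-at-0 : (τ : Char) → χ τ 0G ≈ 1#
    character-at-0 τ with proj₂ isField (χ τ 0G) (nonzero τ 0G)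
    ... | (t , t-inverse) = ≈-sym (begin
        1#                   ≈⟨ ≈-sym t-inverse ⟩
        c₀ *K t              ≈⟨ *-congʳ (≈-sym idempotent) ⟩
        (c₀ *K c₀) *K t      ≈⟨ *-assoc _ _ _ ⟩
        c₀ *K (c₀ *K t)      ≈⟨ *-congˡ t-inverse ⟩
        c₀ *K 1#             ≈⟨ *-identityʳ _ ⟩
        c₀                   ∎)
      where
        c₀ = χ τ 0G
        idempotent : c₀ *K c₀ ≈ c₀
        idempotent = ≈-trans (≈-sym (hom τ 0G 0G)) (reflexive (cong (χ τ) (mkG-+ 0 0 0 0)))

    character-at-mkG : (τ : Char) → ∀ X Y → χ τ (mkG X Y) ≈ (χ τ e₁ ^ X) *K (χ τ e₂ ^ Y)
    character-at-mkG τ zero zero = ≈-trans (character-at-0 τ) (≈-sym (*-identityˡ 1#))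
    character-at-mkG τ zero (suc Y) = begin
      χ τ (mkG 0 (suc Y))                    ≡⟨ cong (χ τ) (P.sym (mkG-+ 0 1 0 Y)) ⟩
      χ τ (e₂ +G mkG 0 Y)                    ≈⟨ hom τ e₂ (mkG 0 Y) ⟩
      χ τ e₂ *K χ τ (mkG 0 Y)                ≈⟨ *-congˡ (character-at-mkG τ zero Y) ⟩
      χ τ e₂ *K (1# *K (χ τ e₂ ^ Y))         ≈⟨ x∙yz≈y∙xz _ _ _ ⟩
      1# *K (χ τ e₂ *K (χ τ e₂ ^ Y))         ∎
    character-at-mkG τ (suc X) Y = begin
      χ τ (mkG (suc X) Y)                              ≡⟨ cong (χ τ) (P.sym (mkG-+ 1 0 X Y)) ⟩
      χ τ (e₁ +G mkG X Y)                              ≈⟨ hom τ e₁ (mkG X Y) ⟩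
      χ τ e₁ *K χ τ (mkG X Y)                          ≈⟨ *-congˡ (character-at-mkG τ X Y) ⟩
      χ τ e₁ *K ((χ τ e₁ ^ X) *K (χ τ e₂ ^ Y))         ≈⟨ ≈-sym (*-assoc _ _ _) ⟩
      (χ τ e₁ *K (χ τ e₁ ^ X)) *K (χ τ e₂ ^ Y)         ∎

    character-on-generators : (τ : Char) → ∀ h →
      χ τ h ≈ (χ τ e₁ ^ coord₁ h) *K (χ τ e₂ ^ coord₂ h)
    character-on-generators τ h =
      ≈-trans (reflexive (cong (χ τ) (P.sym (mkG-coords h)))) (character-at-mkG τ (coord₁ h) (coord₂ h))

  module RootOfUnity (1≉0 : ¬ (1# ≈ 0#)) (w : Carrier) (w^m≈1 : w ^ m ≈ 1#) where

    open ≈-Reasoning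

    ^-multiple : ∀ q → w ^ (q * m) ≈ 1#
    ^-multiple q = begin
      w ^ (q * m)   ≡⟨ cong (w ^_) (*-comm q m) ⟩
      w ^ (m * q)   ≈⟨ ≈-sym (^-assocʳ w m q) ⟩
      (w ^ m) ^ q   ≈⟨ ^-congˡ q w^m≈1 ⟩
      1# ^ q        ≈⟨ 1^ q ⟩
      1#            ∎

    ^-mod : ∀ E → w ^ E ≈ w ^ (E % m)
    ^-mod E = begin
      w ^ E                              ≡⟨ cong (w ^_) (m≡m%n+[m/n]*n E m) ⟩
      w ^ (E % m + E / m * m)            ≈⟨ ^-homo-* w (E % m) (E / m * m) ⟩
      w ^ (E % m) *K w ^ (E / m * m)     ≈⟨ *-congˡ (^-multiple (E / m)) ⟩
      w ^ (E % m) *K 1#                  ≈⟨ *-identityʳ _ ⟩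
      w ^ (E % m)                        ∎

    ^-≋ : ∀ {E E'} → E ≋ E' → w ^ E ≈ w ^ E'
    ^-≋ {E} {E'} E≋E' = ≈-trans (^-mod E) (≈-trans (reflexive (cong (w ^_) E≋E')) (≈-sym (^-mod E')))

    ^-nonzero : ∀ E → ¬ (w ^ E ≈ 0#)
    ^-nonzero E w^E≈0 = 1≉0 (begin
      1#                          ≈⟨ ≈-sym (^-≋ (+-neg E)) ⟩
      w ^ (E + neg E)             ≈⟨ ^-homo-* w E (neg E) ⟩
      w ^ E *K w ^ neg E          ≈⟨ *-congʳ w^E≈0 ⟩
      0# *K w ^ neg E             ≈⟨ zeroˡ _ ⟩
      0#                          ∎)

    linear : ℕ → ℕ → G → ℕ
    linear α β h = α * coord₁ h + β * coord₂ h

    C : ℕ → ℕ → Char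
    C α β = record
      { χ       = λ h → w ^ linear α β h
      ; nonzero = λ h → ^-nonzero (linear α β h)
      ; hom     = λ g h → ≈-trans
          (^-≋ (≋-trans (linear-mkG α β _ _)
                 (≋-reflexive (distribute α β (coord₁ g) (coord₂ g) (coord₁ h) (coord₂ h)))))
          (^-homo-* w (linear α β g) (linear α β h))
      }
      where
        distribute : ∀ α β x y x' y' →
                     α * (x + x') + β * (y + y') ≡ (α * x + β * y) + (α * x' + β * y')
        distribute = solve-∀

    HasExponents : Char → ℕ → ℕ → Set ℓ
    HasExponents ρ a b = ∀ h → χ ρ h ≈ w ^ linear a b h

    Kills : ℕ → ℕ → G → Set
    Kills α β g = linear α β g ≋ 0

    kills-mkG : ∀ α β X Y → α * X + β * Y ≋ 0 → Kills α β (mkG X Y)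
    kills-mkG α β X Y = ≋-trans (linear-mkG α β X Y)

    perp-criterion : ∀ α β g → Kills α β g → InPerp g (C α β)
    perp-criterion α β g kills k =
      ^-≋ (kills-mkG α β (k * coord₁ g) (k * coord₂ g) (scale-≋0 α β k (coord₁ g) (coord₂ g) kills))

    coset-criterion : ∀ {ρ a b} α β α' β' g → HasExponents ρ a b →
                      α + α' ≋ a → β + β' ≋ b → Kills α' β' g → InCoset (C α β) g ρ
    coset-criterion {ρ} {a} {b} α β α' β' g ρ-exp α-sum β-sum kills =
      C α' β' , perp-criterion α' β' g kills , λ h → begin
        χ ρ h                                       ≈⟨ ρ-exp h ⟩
        w ^ linear a b h                            ≈⟨ ^-≋ (linear-split α β α' β' (coord₁ h) (coord₂ h) α-sum β-sum) ⟩
        w ^ (linear α β h + linear α' β' h)         ≈⟨ ^-homo-* w (linear α β h) (linear α' β' h) ⟩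
        w ^ linear α β h *K w ^ linear α' β' h      ∎

    coset-self : ∀ {ρ a b} α β g → HasExponents ρ a b → α ≋ a → β ≋ b → InCoset (C α β) g ρ
    coset-self {ρ} {a} {b} α β g ρ-exp α≋a β≋b =
      coset-criterion {ρ} α β 0 0 g ρ-exp
        (P.subst (_≋ a) (P.sym (+-identityʳ α)) α≋a)
        (P.subst (_≋ b) (P.sym (+-identityʳ β)) β≋b)
        refl

  module Coverings (1≉0 : ¬ (1# ≈ 0#)) (w : Carrier) (w^m≈1 : w ^ m ≈ 1#) (s : ℕ) where

    open RootOfUnity 1≉0 w w^m≈1
    open ≋-Reasoning

    Index : Set
    Index = Fin (s + (m ∸ s) * m)

    Covers : (Index → Char) → (Index → G) → Set (c ⊔ ℓ)
    Covers χs g = ∀ ρ a b → HasExponents ρ a b → ∃ λ i → InCoset (χs i) (g i) ρ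

    first-index : ∀ {γ} → γ < s → Index
    first-index γ<s = fromℕ< γ<s ↑ˡ ((m ∸ s) * m)

    first-index-< : ∀ {γ} (γ<s : γ < s) → toℕ (first-index γ<s) < s
    first-index-< γ<s = subst (_< s) (P.sym (P.trans (toℕ-↑ˡ _ _) (toℕ-fromℕ< γ<s))) γ<s

    offset< : ∀ {t} → s ≤ t → t < m → t ∸ s < m ∸ s
    offset< s≤t t<m = ∸-monoˡ-< t<m s≤t

    second-index : ∀ {t r} → s ≤ t → t < m → r < m → Index
    second-index s≤t t<m r<m = s ↑ʳ combine (fromℕ< (offset< s≤t t<m)) (fromℕ< r<m)

    second-offset : ∀ {t} (s≤t : s ≤ t) (t<m : t < m) → s + toℕ (fromℕ< (offset< s≤t t<m)) ≡ t
    second-offset s≤t t<m = P.trans (cong (s +_) (toℕ-fromℕ< _)) (m+[n∸m]≡n s≤t)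

    residue-≋ : ∀ x {k} (lt : x % m < k) → toℕ (fromℕ< lt) ≋ x
    residue-≋ x lt = P.trans (cong (_% m) (toℕ-fromℕ< lt)) (mod-≋ x)

    -- Case gᵢ = k₀ e₁ + e₂ for i < s.  With γ = (a k₀ + b) mod m, ρ lies in
    -- (C 0 γ)⟨gᵢ⟩^⊥ if γ < s, and equals C (a mod m) (γ - a k₀) otherwise.
    first₁ : Fin s → Char
    first₁ γ = C 0 (toℕ γ)

    second₁ : ℕ → Fin (m ∸ s) → Fin m → Char
    second₁ k₀ u α = C (toℕ α) (neg (toℕ α * k₀) + (s + toℕ u))

    cover₁ : ℕ → Index → Char
    cover₁ k₀ = blocks first₁ (second₁ k₀)

    cover₁-first : ∀ k₀ (g : Index → G) → (∀ i → toℕ i < s → g i ≡ mkG k₀ 1) → ∀ {ρ a b} →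
                   HasExponents ρ a b → (a * k₀ + b) % m < s →
                   ∃ λ i → InCoset (cover₁ k₀ i) (g i) ρ
    cover₁-first k₀ g g-first {ρ} {a} {b} ρ-exp γ<s =
      i , P.subst₂ (λ χ' g' → InCoset χ' g' ρ)
            (P.sym (blocks-first first₁ (second₁ k₀) _)) (P.sym (g-first i (first-index-< γ<s)))
            (coset-criterion {ρ} 0 γ a (b + neg γ) (mkG k₀ 1) ρ-exp refl (cancel-neg γ b)
              (kills-mkG a (b + neg γ) k₀ 1 vanishes))
      where
        i = first-index γ<s
        γ = toℕ (fromℕ< γ<s)
        regroup : ∀ x y z → x + (y + z) * 1 ≡ (x + y) + z
        regroup = solve-∀
        vanishes : a * k₀ + (b + neg γ) * 1 ≋ 0
        vanishes = begin
          a * k₀ + (b + neg γ) * 1   ≡⟨ regroup (a * k₀) b (neg γ) ⟩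
          (a * k₀ + b) + neg γ       ≈⟨ +-≋ (≋-sym (residue-≋ (a * k₀ + b) γ<s)) (≋-refl {neg γ}) ⟩
          γ + neg γ                  ≈⟨ +-neg γ ⟩
          0                          ∎

    cover₁-second : ∀ k₀ (g : Index → G) → ∀ {ρ a b} →
                    HasExponents ρ a b → s ≤ (a * k₀ + b) % m →
                    ∃ λ i → InCoset (cover₁ k₀ i) (g i) ρ
    cover₁-second k₀ g {ρ} {a} {b} ρ-exp s≤γ =
      i , subst (λ χ' → InCoset χ' (g i) ρ) (P.sym (blocks-second first₁ (second₁ k₀) _ _))
            (coset-self {ρ} α _ (g i) ρ-exp (residue-≋ a α<m) β≋b)
      where
        γ<m = m%n<n (a * k₀ + b) m
        α<m = m%n<n a m
        i = second-index s≤γ γ<m α<m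
        α = toℕ (fromℕ< α<m)
        β≋b : neg (α * k₀) + (s + toℕ (fromℕ< (offset< s≤γ γ<m))) ≋ b
        β≋b = begin
          neg (α * k₀) + (s + toℕ (fromℕ< (offset< s≤γ γ<m)))
            ≡⟨ cong (neg (α * k₀) +_) (second-offset s≤γ γ<m) ⟩
          neg (α * k₀) + (a * k₀ + b) % m
            ≈⟨ +-≋ (neg-≋ (*-≋ (residue-≋ a α<m) (≋-refl {k₀}))) (mod-≋ (a * k₀ + b)) ⟩
          neg (a * k₀) + (a * k₀ + b)
            ≈⟨ cancel-negˡ (a * k₀) b ⟩
          b ∎

    cover₁-covers : ∀ k₀ (g : Index → G) → (∀ i → toℕ i < s → g i ≡ mkG k₀ 1) → Covers (cover₁ k₀) g
    cover₁-covers k₀ g g-first ρ a b ρ-exp with (a * k₀ + b) % m <? s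
    ... | yes γ<s = cover₁-first k₀ g g-first {ρ} {a} {b} ρ-exp γ<s
    ... | no  γ≮s = cover₁-second k₀ g {ρ} {a} {b} ρ-exp (≮⇒≥ γ≮s)

    -- Case gᵢ ∈ {k e₁ + m l e₂} for i < s.  With α = a mod m, ρ lies in
    -- (C α 0)⟨gᵢ⟩^⊥ if α < s, since (a - α, b) kills every k e₁ + m l e₂;
    -- otherwise ρ equals C α (b mod m).
    first₂ : Fin s → Char
    first₂ α = C (toℕ α) 0

    second₂ : Fin (m ∸ s) → Fin m → Char
    second₂ u β = C (s + toℕ u) (toℕ β)

    cover₂ : Index → Char
    cover₂ = blocks first₂ second₂

    cover₂-first : ∀ (g : Index → G) →
                   (∀ i → toℕ i < s → Σ ℕ λ k → Σ ℕ λ l → k < m × g i ≡ mkG k (m * l)) →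
                   ∀ {ρ a b} → HasExponents ρ a b → a % m < s →
                   ∃ λ i → InCoset (cover₂ i) (g i) ρ
    cover₂-first g g-first {ρ} {a} {b} ρ-exp α<s with g-first (first-index α<s) (first-index-< α<s)
    ... | k , l , _ , g-at-i =
      first-index α<s ,
        P.subst₂ (λ χ' g' → InCoset χ' g' ρ) (P.sym (blocks-first first₂ second₂ _)) (P.sym g-at-i)
          (coset-criterion {ρ} α 0 (a + neg α) b (mkG k (m * l)) ρ-exp (cancel-neg α a) refl
            (kills-mkG (a + neg α) b k (m * l) vanishes))
      where
        α = toℕ (fromℕ< α<s)
        rearrange : ∀ b m l → b * (m * l) ≡ m * (b * l)
        rearrange = solve-∀
        a-α≋0 : a + neg α ≋ 0
        a-α≋0 = ≋-trans (+-≋ (≋-sym (residue-≋ a α<s)) (≋-refl {neg α})) (+-neg α)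
        vanishes : (a + neg α) * k + b * (m * l) ≋ 0
        vanishes = begin
          (a + neg α) * k + b * (m * l)   ≡⟨ cong ((a + neg α) * k +_) (rearrange b m l) ⟩
          (a + neg α) * k + m * (b * l)   ≈⟨ +-≋ (*-≋ a-α≋0 (≋-refl {k})) (multiple-≋0 (b * l)) ⟩
          0                               ∎

    cover₂-second : ∀ (g : Index → G) → ∀ {ρ a b} →
                    HasExponents ρ a b → s ≤ a % m →
                    ∃ λ i → InCoset (cover₂ i) (g i) ρ
    cover₂-second g {ρ} {a} {b} ρ-exp s≤α =
      i , subst (λ χ' → InCoset χ' (g i) ρ) (P.sym (blocks-second first₂ second₂ _ _))
            (coset-self {ρ} _ _ (g i) ρ-exp
              (P.subst (_≋ a) (P.sym (second-offset s≤α α<m)) (mod-≋ a))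
              (residue-≋ b β<m))
      where
        α<m = m%n<n a m
        β<m = m%n<n b m
        i = second-index s≤α α<m β<m

    cover₂-covers : ∀ (g : Index → G) → (∀ i → toℕ i < s → Σ ℕ λ k → Σ ℕ λ l → k < m × g i ≡ mkG k (m * l)) →
                    Covers cover₂ g
    cover₂-covers g g-first ρ a b ρ-exp with a % m <? s
    ... | yes α<s = cover₂-first g g-first {ρ} {a} {b} ρ-exp α<s
    ... | no  α≮s = cover₂-second g {ρ} {a} {b} ρ-exp (≮⇒≥ α≮s)

  module Generated (isField : IsField K) (ζ : Carrier) (ζ^mn≈1 : ζ ^ (m * n) ≈ 1#) where

    open OnGenerators isField
    open ≈-Reasoning

    w : Carrier
    w = ζ ^ n

    w^m≈1 : w ^ m ≈ 1#
    w^m≈1 = ≈-trans (^-assocʳ ζ n m) (≈-trans (^-congʳ ζ (*-comm n m)) ζ^mn≈1)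

    open RootOfUnity (proj₁ isField) w w^m≈1

    -- ψᵃ(φⁿ)ᵇ has exponent pair (a, b), as ψ(h) = w^x and φⁿ(h) = ζ^(n y) = w^y
    generated-exponents : (ψ φ : Char) →
      χ ψ e₁ ≈ w → χ ψ e₂ ≈ 1# → χ φ e₁ ≈ 1# → χ φ e₂ ≈ ζ →
      ∀ ρ → InGen2 ψ φ ρ → Σ ℕ λ a → Σ ℕ λ b → HasExponents ρ a b
    generated-exponents ψ φ ψ₁ ψ₂ φ₁ φ₂ ρ (a , b , ρ≈) = a , b , λ h →
      let x = coord₁ h
          y = coord₂ h
          ψ-at : χ ψ h ≈ w ^ x
          ψ-at = ≈-trans (character-on-generators ψ h) (≈-trans (*-cong (^-congˡ x ψ₁) (^-congˡ y ψ₂))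
                   (≈-trans (*-congˡ (1^ y)) (*-identityʳ _)))
          φ-at : χ φ h ≈ ζ ^ y
          φ-at = ≈-trans (character-on-generators φ h) (≈-trans (*-cong (^-congˡ x φ₁) (^-congˡ y φ₂))
                   (≈-trans (*-congʳ (1^ x)) (*-identityˡ _)))
          φⁿ-at : χ φ h ^ n ≈ w ^ y
          φⁿ-at = ≈-trans (^-congˡ n φ-at) (≈-trans (^-assocʳ ζ y n)
                    (≈-trans (^-congʳ ζ (*-comm y n)) (≈-sym (^-assocʳ ζ n y))))
      in begin
        χ ρ h                                ≈⟨ ρ≈ h ⟩
        (χ ψ h ^ a) *K ((χ φ h ^ n) ^ b)     ≈⟨ *-cong (^-congˡ a ψ-at) (^-congˡ b φⁿ-at) ⟩
        ((w ^ x) ^ a) *K ((w ^ y) ^ b)       ≈⟨ *-cong (^-assocʳ w x a) (^-assocʳ w y b) ⟩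
        (w ^ (x * a)) *K (w ^ (y * b))       ≈⟨ ≈-sym (^-homo-* w (x * a) (y * b)) ⟩
        w ^ (x * a + y * b)                  ≡⟨ cong (w ^_) (cong₂ _+_ (*-comm x a) (*-comm y b)) ⟩
        w ^ linear a b h                     ∎

lemma3p5 : ∀ {c ℓ} (K : CommutativeRing c ℓ) (m n : ℕ)
    .{{_ : NonZero m}} .{{_ : NonZero n}} → 2 ≤ m → 1 ≤ n →
    let open CommutativeRing K
        open Setup K m n
    in IsSplittingField →
    (ζ : Carrier) → IsPrimitiveRoot (m *ℕ n) ζ →
    (ψ φ : Char) →
    χ ψ e₁ ≈ ζ ^K n → χ ψ e₂ ≈ 1# →
    χ φ e₁ ≈ 1# → χ φ e₂ ≈ ζ →
    (s : ℕ) → s ≤ m →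
    (g : Fin (s +ℕ (m ∸ s) *ℕ m) → G) →
    ((Σ ℕ λ k → k < m × (∀ i → toℕ i < s → g i ≡ mkG k 1))
     ⊎ (∀ i → toℕ i < s →
          Σ ℕ λ k → Σ ℕ λ l → k < m × g i ≡ mkG k (m *ℕ l))) →
    Σ (Fin (s +ℕ (m ∸ s) *ℕ m) → Char) λ χs →
      ∀ ρ → InGen2 ψ φ ρ → ∃ λ i → InCoset (χs i) (g i) ρ
lemma3p5 K m n _ _ (isField , _) ζ (ζ^mn≈1 , _) ψ φ ψ₁ ψ₂ φ₁ φ₂ s _ g shape =
  proj₁ covering , λ ρ ρ∈⟨ψ,φⁿ⟩ →
    let (a , b , ρ-exp) = generated-exponents ψ φ ψ₁ ψ₂ φ₁ φ₂ ρ ρ∈⟨ψ,φⁿ⟩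
    in proj₂ covering ρ a b ρ-exp
  where
    open Setup K m n using (Char)
    open Characters K m n
    open Generated isField ζ ζ^mn≈1 using (w; w^m≈1; generated-exponents)
    open Coverings (proj₁ isField) w w^m≈1 s

    covering : Σ (Index → Char) λ χs → Covers χs g
    covering = [ (λ { (k₀ , _ , g-first) → cover₁ k₀ , cover₁-covers k₀ g g-first })
               , (λ g-first → cover₂ , cover₂-covers g g-first) ]′ shape
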